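{- Let $k, m, n$ be integers with $3 \leq k \leq m$ and $\binom{m}{k-2} \leq n \leq (k-1)\binom{m}{k-1}$. Then $$N(n,k,m) = n(k-1) - \left\lfloor \frac{(k-1)\binom{m}{k-1} - n}{m-k+1} \right\rfloor.$$
   Context: An $(n, N, k, m)$-CBC is a pair $(\mathcal{S}, \mathcal{X})$ where $\mathcal{S}$ is a set of $m$ elements and $\mathcal{X} = (X_1, \ldots, X_n)$ is a list (repetitions allowed) of $n$ subsets of $\mathcal{S}$ with $\sum_{j=1}^n |X_j| = N$, such that for every choice of $r$ distinct indices $i_1, \ldots, i_r$ with $1 \leq r \leq k$ one has $|X_{i_1} \cup \cdots \cup X_{i_r}| \geq r$. $N(n,k,m)$ denotes the minimum $N$ for which an $(n, N, k, m)$-CBC exists. -}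

module Defs where

open import Data.Nat using (ℕ; _+_; _≤_; _≥_)
open import Data.Bool using (if_then_else_)
open import Data.Fin using (Fin)
open import Data.Fin.Subset using (Subset; ⋃; ∣_∣; ⊥)
open import Data.List using (List; map; allFin)
open import Data.Nat.ListAction using (sum)
open import Relation.Binary.PropositionalEquality using (_≡_)
open import Data.Vec using (Vec; lookup)
open import Data.Product using (Σ; _×_)

-- The ground set 𝒮 is Fin m (a set of m elements); subsets of it are 'Subset m'.
-- A list 𝒳 = (X_1,…,X_n) of n subsets (repetitions allowed) is a Vec (Subset m) n.

unionOver : ∀ {n m} → Vec (Subset m) n → Subset n → Subset m
unionOver {n} X I = ⋃ (map (λ i → if lookup I i then lookup X i else ⊥) (allFin n))

totalSize : ∀ {n m} → Vec (Subset m) n → ℕ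
totalSize {n} X = sum (map (λ j → ∣ lookup X j ∣) (allFin n))

IsCBC : ∀ {n m} → ℕ → Vec (Subset m) n → Set
IsCBC {n} k X = (I : Subset n) → 1 ≤ ∣ I ∣ → ∣ I ∣ ≤ k → ∣ unionOver X I ∣ ≥ ∣ I ∣

CBC : ℕ → ℕ → ℕ → ℕ → Set
CBC n N k m = Σ (Vec (Subset m) n) λ X → IsCBC k X × totalSize X ≡ N

IsMinN : ℕ → ℕ → ℕ → ℕ → Set
IsMinN n k m v = CBC n v k m × (∀ N → CBC n N k m → v ≤ N)

module Submission where

-- Write t = k − 1, s = t − 1 and d = m − t ≥ 1. The CBC condition is a Hall-type condition:
-- every V ⊆ 𝒮 with ∣ V ∣ ≤ t contains at most ∣ V ∣ of the X_j.
--
-- Lower bound: a set U with ∣ U ∣ = t − u has (d + u choose u) ≥ 1 + d u supersets of size t, so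
-- d t + 1 ≤ d ∣ U ∣ + #{T ⊇ U : ∣ T ∣ = t} for every U (trivially when ∣ U ∣ > t). Summing over the
-- X_j and using that each t-set contains at most t of them gives n (d t + 1) ≤ d N + t (m choose t),
-- that is N ≥ n t − ⌊(t (m choose t) − n) / d⌋.
--
-- Upper bound: with q = ⌊(t (m choose t) − n) / d⌋, take q distinct s-sets and n − q sets of size
-- t, each t-set T used at most t − #{chosen s-sets inside T} times. Double counting gives
-- t (m choose t) = (d + 1) (m choose s), which yields both q ≤ (m choose s) and enough room for the
-- n − q sets of size t. The Hall-type condition then holds by construction, and the total size is
-- q s + (n − q) t = n t − q.

open import Defs
open import Data.Bool using (true; false; if_then_else_)
open import Data.Empty using (⊥-elim)
open import Data.Fin using (Fin)
open import Data.Fin.Subset using (Subset; ∣_∣; _⊆_; _∈_; ⋃; ⊥; ∁; inside; outside)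
open import Data.Fin.Subset.Properties using (_⊆?_; drop-∷-⊆; s⊆s; ⊥⊆; ∣⊥∣≡0; p⊆p∪q; q⊆p∪q; x∈p∪q⁻; p⊆q⇒∣p∣≤∣q∣; ∣∁p∣≡n∸∣p∣)
import Data.List as List
open import Data.List.Membership.Propositional using () renaming (_∈_ to _∈ₗ_)
open import Data.List.Membership.Propositional.Properties using (∈-map⁺; ∈-map⁻; ∈-allFin)
open import Data.List.Properties using (map-tabulate)
open import Data.List.Relation.Unary.Any using () renaming (here to hereₗ; there to thereₗ)
open import Data.Nat using (ℕ; NonZero; zero; suc; _+_; _*_; _∸_; _/_; _≤_; _<_; z≤n; s≤s)
open import Data.Nat.Combinatorics using (_C_; nC1≡n; nCn≡1; k>n⇒nCk≡0; nCk≡nC[n∸k]; nCk+nC[k+1]≡[n+1]C[k+1])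
open import Data.Nat.DivMod using (m*n/n≡m; m/n*n≤m; /-monoˡ-≤)
open import Data.Nat.ListAction using () renaming (sum to sumₗ)
open import Data.Nat.Properties
open import Algebra.Properties.CommutativeSemigroup +-commutativeSemigroup using () renaming (interchange to +-interchange)
open import Algebra.Properties.CommutativeSemigroup *-commutativeSemigroup using () renaming (x∙yz≈y∙xz to *-left-comm)
open import Data.Nat.Solver using (module +-*-Solver)
open +-*-Solver using (solve; _:=_; _:+_; _:*_; con)
open import Data.Product using (Σ-syntax; _×_; _,_; proj₁; proj₂)
open import Data.Sum using ([_,_]′; inj₁; inj₂)
open import Data.Vec using (Vec; []; _∷_; here; _++_; map; sum; lookup; tabulate; replicate)
open import Data.Vec.Properties using (lookup∘tabulate; []=⇒lookup; lookup⇒[]=; map-++; map-∘; sum-++; ∷-injectiveʳ)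
open import Function using (_∘_; id)
open import Relation.Binary.PropositionalEquality
open import Relation.Nullary using (Dec; yes; no; does; ¬_)
open import Relation.Nullary.Decidable using (dec-true; dec-false)

-- Sums over the subsets of Fin m

𝟙 : ∀ {p} {P : Set p} → Dec P → ℕ
𝟙 d = if does d then 1 else 0

𝟙-no : ∀ {p} {P : Set p} (d : Dec P) → ¬ P → 𝟙 d ≡ 0
𝟙-no d ¬x = cong (λ b → if b then 1 else 0) (dec-false d ¬x)

𝟙*x≤x : ∀ {p} {P : Set p} (d : Dec P) x → 𝟙 d * x ≤ x
𝟙*x≤x d x with does d
... | true  = ≤-reflexive (+-identityʳ x)
... | false = z≤n

𝟙≟-*-cong : ∀ a b {x y} → (a ≡ b → x ≡ y) → 𝟙 (a ≟ b) * x ≡ 𝟙 (a ≟ b) * y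
𝟙≟-*-cong a b x≡y with a ≟ b
... | yes a≡b = cong (𝟙 (a ≟ b) *_) (x≡y a≡b)
... | no  a≢b rewrite 𝟙-no (a ≟ b) a≢b = refl

𝟙≟-*-mono-≤ : ∀ a b {x y} → (a ≡ b → x ≤ y) → 𝟙 (a ≟ b) * x ≤ 𝟙 (a ≟ b) * y
𝟙≟-*-mono-≤ a b x≤y with a ≟ b
... | yes a≡b = *-monoʳ-≤ (𝟙 (a ≟ b)) (x≤y a≡b)
... | no  a≢b rewrite 𝟙-no (a ≟ b) a≢b = z≤n

*-congˡ-on : ∀ {b j} a {x y} → (b ≢ j → a ≡ 0) → (b ≡ j → x ≡ y) → a * x ≡ a * y
*-congˡ-on {b} {j} a a≡0 x≡y with b ≟ j
... | yes b≡j = cong (a *_) (x≡y b≡j)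
... | no  b≢j rewrite a≡0 b≢j = refl

∑ : (m : ℕ) → (Subset m → ℕ) → ℕ
∑ zero    f = f []
∑ (suc m) f = ∑ m (λ S → f (inside ∷ S)) + ∑ m (λ S → f (outside ∷ S))

∑-cong : ∀ m {f g : Subset m → ℕ} → (∀ S → f S ≡ g S) → ∑ m f ≡ ∑ m g
∑-cong zero    f≡g = f≡g []
∑-cong (suc m) f≡g = cong₂ _+_ (∑-cong m (f≡g ∘ (inside ∷_))) (∑-cong m (f≡g ∘ (outside ∷_)))

∑-mono-≤ : ∀ m {f g : Subset m → ℕ} → (∀ S → f S ≤ g S) → ∑ m f ≤ ∑ m g
∑-mono-≤ zero    f≤g = f≤g []
∑-mono-≤ (suc m) f≤g = +-mono-≤ (∑-mono-≤ m (f≤g ∘ (inside ∷_))) (∑-mono-≤ m (f≤g ∘ (outside ∷_)))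

∑-zero : ∀ m {f : Subset m → ℕ} → (∀ S → f S ≡ 0) → ∑ m f ≡ 0
∑-zero zero    f≡0 = f≡0 []
∑-zero (suc m) f≡0 = cong₂ _+_ (∑-zero m (f≡0 ∘ (inside ∷_))) (∑-zero m (f≡0 ∘ (outside ∷_)))

∑-single : ∀ m V {f : Subset m → ℕ} → (∀ S → S ≢ V → f S ≡ 0) → ∑ m f ≡ f V
∑-single zero    []            f≡0 = refl
∑-single (suc m) (inside ∷ V)  f≡0 = trans
  (cong₂ _+_ (∑-single m V (λ S S≢V → f≡0 _ (S≢V ∘ ∷-injectiveʳ))) (∑-zero m (λ S → f≡0 _ λ ())))
  (+-identityʳ _)
∑-single (suc m) (outside ∷ V) f≡0 =
  cong₂ _+_ (∑-zero m (λ S → f≡0 _ λ ())) (∑-single m V (λ S S≢V → f≡0 _ (S≢V ∘ ∷-injectiveʳ)))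

∑-distrib-+ : ∀ m (f g : Subset m → ℕ) → ∑ m (λ S → f S + g S) ≡ ∑ m f + ∑ m g
∑-distrib-+ zero    f g = refl
∑-distrib-+ (suc m) f g = trans
  (cong₂ _+_ (∑-distrib-+ m _ _) (∑-distrib-+ m _ _))
  (+-interchange (∑ m (f ∘ (inside ∷_))) _ _ _)

*-distribˡ-∑ : ∀ m c (f : Subset m → ℕ) → c * ∑ m f ≡ ∑ m (λ S → c * f S)
*-distribˡ-∑ zero    c f = refl
*-distribˡ-∑ (suc m) c f = trans (*-distribˡ-+ c _ _) (cong₂ _+_ (*-distribˡ-∑ m c _) (*-distribˡ-∑ m c _))

∑-comm : ∀ m m′ (F : Subset m → Subset m′ → ℕ) → ∑ m (λ S → ∑ m′ (F S)) ≡ ∑ m′ (λ T → ∑ m (λ S → F S T))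
∑-comm zero    m′ F = refl
∑-comm (suc m) m′ F = trans (cong₂ _+_ (∑-comm m m′ _) (∑-comm m m′ _)) (sym (∑-distrib-+ m′ _ _))

∑-∸ : ∀ m (f g : Subset m → ℕ) → ∑ m f ∸ ∑ m g ≤ ∑ m (λ S → f S ∸ g S)
∑-∸ zero    f g = ≤-refl
∑-∸ (suc m) f g = ≤-trans (+-∸-+ (∑ m f₁) (∑ m f₀) (∑ m g₁) (∑ m g₀)) (+-mono-≤ (∑-∸ m f₁ g₁) (∑-∸ m f₀ g₀))
  where
  f₁ f₀ g₁ g₀ : Subset m → ℕ
  f₁ = f ∘ (inside ∷_)
  f₀ = f ∘ (outside ∷_)
  g₁ = g ∘ (inside ∷_)
  g₀ = g ∘ (outside ∷_)
  +-∸-+ : ∀ a b c d → (a + b) ∸ (c + d) ≤ (a ∸ c) + (b ∸ d)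
  +-∸-+ a b c d = m≤n+o⇒m∸n≤o (a + b) (c + d) (begin
    a + b                   ≤⟨ +-mono-≤ (m≤n+m∸n a c) (m≤n+m∸n b d) ⟩
    (c + (a ∸ c)) + (d + (b ∸ d)) ≡⟨ +-interchange c _ d _ ⟩
    (c + d) + ((a ∸ c) + (b ∸ d)) ∎)
    where open ≤-Reasoning

-- Binomial coefficients

[1+s]Cs≡1+s : ∀ s → suc s C s ≡ suc s
[1+s]Cs≡1+s s = begin
  suc s C s               ≡⟨ nCk≡nC[n∸k] (n≤1+n s) ⟩
  suc s C (suc s ∸ s)     ≡⟨ cong (suc s C_) (m+n∸n≡m 1 s) ⟩
  suc s C 1               ≡⟨ nC1≡n (suc s) ⟩
  suc s                   ∎
  where open ≡-Reasoning

pascal-+ : ∀ d u k → (d + u) C k + (d + u) C suc k ≡ (d + suc u) C suc k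
pascal-+ d u k = trans (nCk+nC[k+1]≡[n+1]C[k+1] (d + u) k) (cong (_C suc k) (sym (+-suc d u)))

d≤[d+u]C[1+u] : ∀ d u → d ≤ (d + u) C suc u
d≤[d+u]C[1+u] d zero    = ≤-reflexive (sym (trans (cong (_C 1) (+-identityʳ d)) (nC1≡n d)))
d≤[d+u]C[1+u] d (suc u) = begin
  d                                                     ≤⟨ d≤[d+u]C[1+u] d u ⟩
  (d + u) C suc u                                       ≤⟨ m≤m+n _ _ ⟩
  (d + u) C suc u + (d + u) C suc (suc u)               ≡⟨ pascal-+ d u (suc u) ⟩
  (d + suc u) C suc (suc u)                             ∎
  where open ≤-Reasoning

1+d*u≤[d+u]Cu : ∀ d u → 1 + d * u ≤ (d + u) C u
1+d*u≤[d+u]Cu d zero    = ≤-reflexive (cong suc (*-zeroʳ d))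
1+d*u≤[d+u]Cu d (suc u) = begin
  1 + d * suc u                       ≡⟨ cong suc (trans (*-suc d u) (+-comm d (d * u))) ⟩
  (1 + d * u) + d                     ≤⟨ +-mono-≤ (1+d*u≤[d+u]Cu d u) (d≤[d+u]C[1+u] d u) ⟩
  (d + u) C u + (d + u) C suc u       ≡⟨ pascal-+ d u u ⟩
  (d + suc u) C suc u                 ∎
  where open ≤-Reasoning

vCs≤v : ∀ {v s} → v ≤ s → 1 ≤ s → v C s ≤ v
vCs≤v {v} {s} v≤s 1≤s with m≤n⇒m<n∨m≡n v≤s
... | inj₁ v<s  = ≤-trans (≤-reflexive (k>n⇒nCk≡0 v<s)) z≤n
... | inj₂ refl = ≤-trans (≤-reflexive (nCn≡1 v)) 1≤s

∑-ofSize : ∀ m j → ∑ m (λ T → 𝟙 (∣ T ∣ ≟ j)) ≡ m C j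
∑-ofSize zero    zero    = refl
∑-ofSize zero    (suc j) = refl
∑-ofSize (suc m) zero    = cong₂ _+_ (∑-zero m (λ _ → refl)) (∑-ofSize m zero)
∑-ofSize (suc m) (suc j) =
  trans (cong₂ _+_ (∑-ofSize m j) (∑-ofSize m (suc j))) (nCk+nC[k+1]≡[n+1]C[k+1] m j)

∑-ofSize-⊆ : ∀ {m} (V : Subset m) j → ∑ m (λ S → 𝟙 (∣ S ∣ ≟ j) * 𝟙 (S ⊆? V)) ≡ ∣ V ∣ C j
∑-ofSize-⊆         []            zero    = refl
∑-ofSize-⊆         []            (suc j) = refl
∑-ofSize-⊆ {suc m} (inside ∷ V)  zero    = cong₂ _+_ (∑-zero m (λ _ → refl)) (∑-ofSize-⊆ V zero)
∑-ofSize-⊆         (inside ∷ V)  (suc j) =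
  trans (cong₂ _+_ (∑-ofSize-⊆ V j) (∑-ofSize-⊆ V (suc j))) (nCk+nC[k+1]≡[n+1]C[k+1] ∣ V ∣ j)
∑-ofSize-⊆ {suc m} (outside ∷ V) j       =
  cong₂ _+_ (∑-zero m (λ S → *-zeroʳ (𝟙 (suc ∣ S ∣ ≟ j)))) (∑-ofSize-⊆ V j)

supersetsOfSize : ∀ {m} → ℕ → Subset m → ℕ
supersetsOfSize {m} t S = ∑ m (λ T → 𝟙 (∣ T ∣ ≟ t) * 𝟙 (S ⊆? T))

supersetsOfSize-+ : ∀ {m} (S : Subset m) u → supersetsOfSize (∣ S ∣ + u) S ≡ ∣ ∁ S ∣ C u
supersetsOfSize-+ []            zero    = refl
supersetsOfSize-+ []            (suc u) = refl
supersetsOfSize-+ {suc m} (inside ∷ S) u = trans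
  (cong₂ _+_ (supersetsOfSize-+ S u) (∑-zero m (λ T → *-zeroʳ (𝟙 (∣ T ∣ ≟ suc (∣ S ∣ + u))))))
  (+-identityʳ _)
supersetsOfSize-+ {suc m} (outside ∷ S) zero = cong₂ _+_ (∑-zero m too-small) (supersetsOfSize-+ S zero)
  where
  too-small : ∀ T → 𝟙 (suc ∣ T ∣ ≟ ∣ S ∣ + 0) * 𝟙 (S ⊆? T) ≡ 0
  too-small T with S ⊆? T
  ... | no  _   = *-zeroʳ (𝟙 (suc ∣ T ∣ ≟ ∣ S ∣ + 0))
  ... | yes S⊆T = cong (_* 1) (𝟙-no (_ ≟ _) (>⇒≢ (s≤s (≤-trans (≤-reflexive (+-identityʳ ∣ S ∣)) (p⊆q⇒∣p∣≤∣q∣ S⊆T)))))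
supersetsOfSize-+ {suc m} (outside ∷ S) (suc u) = trans
  (cong₂ _+_ (trans (∑-cong _ (λ T → cong (λ t → 𝟙 (suc ∣ T ∣ ≟ t) * 𝟙 (S ⊆? T)) (+-suc ∣ S ∣ u)))
                    (supersetsOfSize-+ S u))
             (supersetsOfSize-+ S (suc u)))
  (nCk+nC[k+1]≡[n+1]C[k+1] ∣ ∁ S ∣ u)

∑-incidence : ∀ m t (g : Subset m → ℕ) →
  ∑ m (λ T → 𝟙 (∣ T ∣ ≟ t) * ∑ m (λ S → g S * 𝟙 (S ⊆? T))) ≡ ∑ m (λ S → g S * supersetsOfSize t S)
∑-incidence m t g = begin
  ∑ m (λ T → 𝟙 (∣ T ∣ ≟ t) * ∑ m (λ S → g S * 𝟙 (S ⊆? T)))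
    ≡⟨ ∑-cong m (λ T → *-distribˡ-∑ m (𝟙 (∣ T ∣ ≟ t)) (λ S → g S * 𝟙 (S ⊆? T))) ⟩
  ∑ m (λ T → ∑ m (λ S → 𝟙 (∣ T ∣ ≟ t) * (g S * 𝟙 (S ⊆? T))))
    ≡⟨ ∑-comm m m _ ⟩
  ∑ m (λ S → ∑ m (λ T → 𝟙 (∣ T ∣ ≟ t) * (g S * 𝟙 (S ⊆? T))))
    ≡⟨ ∑-cong m (λ S → ∑-cong m (λ T → *-left-comm (𝟙 (∣ T ∣ ≟ t)) (g S) _)) ⟩
  ∑ m (λ S → ∑ m (λ T → g S * (𝟙 (∣ T ∣ ≟ t) * 𝟙 (S ⊆? T))))
    ≡⟨ ∑-cong m (λ S → *-distribˡ-∑ m (g S) (λ T → 𝟙 (∣ T ∣ ≟ t) * 𝟙 (S ⊆? T))) ⟨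
  ∑ m (λ S → g S * supersetsOfSize t S) ∎
  where open ≡-Reasoning

supersetsOfSize-suc : ∀ {m s} (S : Subset m) → ∣ S ∣ ≡ s → supersetsOfSize (suc s) S ≡ m ∸ s
supersetsOfSize-suc {m} S refl = begin
  supersetsOfSize (suc ∣ S ∣) S   ≡⟨ cong (λ t → supersetsOfSize t S) (+-comm 1 ∣ S ∣) ⟩
  supersetsOfSize (∣ S ∣ + 1) S   ≡⟨ supersetsOfSize-+ S 1 ⟩
  ∣ ∁ S ∣ C 1                     ≡⟨ nC1≡n ∣ ∁ S ∣ ⟩
  ∣ ∁ S ∣                         ≡⟨ ∣∁p∣≡n∸∣p∣ S ⟩
  m ∸ ∣ S ∣                       ∎
  where open ≡-Reasoning

-- Double counting the pairs S ⊂ T with ∣ S ∣ = s and ∣ T ∣ = s + 1.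
[1+s]*mC[1+s]≡[m∸s]*mCs : ∀ m s → suc s * (m C suc s) ≡ (m ∸ s) * (m C s)
[1+s]*mC[1+s]≡[m∸s]*mCs m s = begin
  suc s * (m C suc s)
    ≡⟨ cong (suc s *_) (∑-ofSize m (suc s)) ⟨
  suc s * ∑ m (λ T → 𝟙 (∣ T ∣ ≟ suc s))
    ≡⟨ *-distribˡ-∑ m (suc s) _ ⟩
  ∑ m (λ T → suc s * 𝟙 (∣ T ∣ ≟ suc s))
    ≡⟨ ∑-cong m (λ T → trans (*-comm (suc s) _) (𝟙≟-*-cong ∣ T ∣ (suc s) λ e → sym (trans (cong (_C s) e) ([1+s]Cs≡1+s s)))) ⟩
  ∑ m (λ T → 𝟙 (∣ T ∣ ≟ suc s) * (∣ T ∣ C s))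
    ≡⟨ ∑-cong m (λ T → cong (𝟙 (∣ T ∣ ≟ suc s) *_) (∑-ofSize-⊆ T s)) ⟨
  ∑ m (λ T → 𝟙 (∣ T ∣ ≟ suc s) * ∑ m (λ S → 𝟙 (∣ S ∣ ≟ s) * 𝟙 (S ⊆? T)))
    ≡⟨ ∑-incidence m (suc s) (λ S → 𝟙 (∣ S ∣ ≟ s)) ⟩
  ∑ m (λ S → 𝟙 (∣ S ∣ ≟ s) * supersetsOfSize (suc s) S)
    ≡⟨ ∑-cong m (λ S → trans (𝟙≟-*-cong ∣ S ∣ s (supersetsOfSize-suc S)) (*-comm _ (m ∸ s))) ⟩
  ∑ m (λ S → (m ∸ s) * 𝟙 (∣ S ∣ ≟ s))
    ≡⟨ *-distribˡ-∑ m (m ∸ s) _ ⟨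
  (m ∸ s) * ∑ m (λ S → 𝟙 (∣ S ∣ ≟ s))
    ≡⟨ cong ((m ∸ s) *_) (∑-ofSize m s) ⟩
  (m ∸ s) * (m C s) ∎
  where open ≡-Reasoning

⊆∧∣≡∣⇒≡ : ∀ {n} {p q : Subset n} → p ⊆ q → ∣ p ∣ ≡ ∣ q ∣ → p ≡ q
⊆∧∣≡∣⇒≡ {p = []}          {[]}          _   _ = refl
⊆∧∣≡∣⇒≡ {p = inside  ∷ p} {inside  ∷ q} p⊆q e = cong (inside ∷_) (⊆∧∣≡∣⇒≡ (drop-∷-⊆ p⊆q) (suc-injective e))
⊆∧∣≡∣⇒≡ {p = inside  ∷ p} {outside ∷ q} p⊆q e with p⊆q here
... | ()
⊆∧∣≡∣⇒≡ {p = outside ∷ p} {inside  ∷ q} p⊆q e = ⊥-elim (1+n≰n (subst (_≤ ∣ q ∣) e (p⊆q⇒∣p∣≤∣q∣ (drop-∷-⊆ p⊆q))))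
⊆∧∣≡∣⇒≡ {p = outside ∷ p} {outside ∷ q} p⊆q e = cong (outside ∷_) (⊆∧∣≡∣⇒≡ (drop-∷-⊆ p⊆q) e)

⊆-ofSize : ∀ {n} (J : Subset n) r → r ≤ ∣ J ∣ → Σ[ I ∈ Subset n ] I ⊆ J × ∣ I ∣ ≡ r
⊆-ofSize {n} J             zero    _ = ⊥ , ⊥⊆ , ∣⊥∣≡0 n
⊆-ofSize     (inside ∷ J)  (suc r) (s≤s r≤∣J∣) with ⊆-ofSize J r r≤∣J∣
... | I , I⊆J , ∣I∣≡r = inside ∷ I , s⊆s I⊆J , cong suc ∣I∣≡r
⊆-ofSize     (outside ∷ J) (suc r) r<∣J∣ with ⊆-ofSize J (suc r) r<∣J∣
... | I , I⊆J , ∣I∣≡r = outside ∷ I , s⊆s I⊆J , ∣I∣≡r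

⋃-⊆ : ∀ {m} (ps : List.List (Subset m)) {V} → (∀ {p} → p ∈ₗ ps → p ⊆ V) → ⋃ ps ⊆ V
⋃-⊆ List.[]       ps⊆V = ⊥⊆
⋃-⊆ (p List.∷ ps) ps⊆V = [ ps⊆V (hereₗ refl) , ⋃-⊆ ps (ps⊆V ∘ thereₗ) ]′ ∘ x∈p∪q⁻ p (⋃ ps)

⊆-⋃ : ∀ {m} {p} {ps : List.List (Subset m)} → p ∈ₗ ps → p ⊆ ⋃ ps
⊆-⋃ {ps = _ List.∷ ps} (hereₗ refl) = p⊆p∪q (⋃ ps)
⊆-⋃ {ps = q List.∷ ps} (thereₗ p∈ps) = q⊆p∪q q (⋃ ps) ∘ ⊆-⋃ p∈ps

module _ {n m} (X : Vec (Subset m) n) (I : Subset n) where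

  private
    member : Fin n → Subset m
    member i = if lookup I i then lookup X i else ⊥

  unionOver-⊆ : ∀ {V} → (∀ {i} → i ∈ I → lookup X i ⊆ V) → unionOver X I ⊆ V
  unionOver-⊆ {V} I⊆V = ⋃-⊆ (List.map member (List.allFin n)) member⊆V
    where
    member⊆V : ∀ {p} → p ∈ₗ List.map member (List.allFin n) → p ⊆ V
    member⊆V p∈ with ∈-map⁻ member p∈
    ... | i , _ , refl with lookup I i in I[i]
    ...   | inside  = I⊆V (lookup⇒[]= i I I[i])
    ...   | outside = ⊥⊆

  ⊆-unionOver : ∀ {i} → i ∈ I → lookup X i ⊆ unionOver X I
  ⊆-unionOver {i} i∈I with ⊆-⋃ (∈-map⁺ member (∈-allFin i))
  ... | member⊆ rewrite []=⇒lookup i∈I = member⊆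

sum-map-mono-≤ : ∀ {A : Set} {n} (X : Vec A n) {f g : A → ℕ} → (∀ a → f a ≤ g a) → sum (map f X) ≤ sum (map g X)
sum-map-mono-≤ []      f≤g = z≤n
sum-map-mono-≤ (x ∷ X) f≤g = +-mono-≤ (f≤g x) (sum-map-mono-≤ X f≤g)

sum-map-distrib-+ : ∀ {A : Set} {n} (X : Vec A n) (f g : A → ℕ) →
  sum (map (λ a → f a + g a) X) ≡ sum (map f X) + sum (map g X)
sum-map-distrib-+ []      f g = refl
sum-map-distrib-+ (x ∷ X) f g =
  trans (cong (f x + g x +_) (sum-map-distrib-+ X f g)) (+-interchange (f x) (g x) _ _)

*-distribˡ-sum-map : ∀ {A : Set} {n} (X : Vec A n) c (f : A → ℕ) → c * sum (map f X) ≡ sum (map (λ a → c * f a) X)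
*-distribˡ-sum-map []      c f = *-zeroʳ c
*-distribˡ-sum-map (x ∷ X) c f = trans (*-distribˡ-+ c (f x) _) (cong (c * f x +_) (*-distribˡ-sum-map X c f))

sum-map-const : ∀ {A : Set} {n} (X : Vec A n) c → sum (map (λ _ → c) X) ≡ n * c
sum-map-const []      c = refl
sum-map-const (x ∷ X) c = cong (c +_) (sum-map-const X c)

sum-map-∑ : ∀ {n} m (X : Vec (Subset m) n) (F : Subset m → Subset m → ℕ) →
  sum (map (λ U → ∑ m (F U)) X) ≡ ∑ m (λ T → sum (map (λ U → F U T) X))
sum-map-∑ m []      F = sym (∑-zero m (λ _ → refl))
sum-map-∑ m (x ∷ X) F = trans (cong (∑ m (F x) +_) (sum-map-∑ m X F)) (sym (∑-distrib-+ m _ _))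

totalSize≡sum : ∀ {n m} (X : Vec (Subset m) n) → totalSize X ≡ sum (map ∣_∣ X)
totalSize≡sum {n} X = trans (cong sumₗ (map-tabulate (λ j → j) (λ j → ∣ lookup X j ∣))) (sum-tabulate X)
  where
  sum-tabulate : ∀ {n} (X : Vec (Subset _) n) → sumₗ (List.tabulate (λ j → ∣ lookup X j ∣)) ≡ sum (map ∣_∣ X)
  sum-tabulate []      = refl
  sum-tabulate (x ∷ X) = cong (∣ x ∣ +_) (sum-tabulate X)

-- Hall-type form of the CBC condition

countWithin : ∀ {n m} → Vec (Subset m) n → Subset m → ℕ
countWithin X V = sum (map (λ U → 𝟙 (U ⊆? V)) X)

indicesWithin : ∀ {n m} → Vec (Subset m) n → Subset m → Subset n
indicesWithin X V = tabulate (λ j → does (lookup X j ⊆? V))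

∣indicesWithin∣ : ∀ {n m} (X : Vec (Subset m) n) V → ∣ indicesWithin X V ∣ ≡ countWithin X V
∣indicesWithin∣ []      V = refl
∣indicesWithin∣ (U ∷ X) V with U ⊆? V
... | yes _ = cong suc (∣indicesWithin∣ X V)
... | no  _ = ∣indicesWithin∣ X V

∈indicesWithin⇒⊆ : ∀ {n m} (X : Vec (Subset m) n) V {j} → j ∈ indicesWithin X V → lookup X j ⊆ V
∈indicesWithin⇒⊆ X V {j} j∈ with lookup X j ⊆? V | trans (sym (lookup∘tabulate _ j)) ([]=⇒lookup j∈)
... | yes X[j]⊆V | _ = X[j]⊆V
... | no  _      | ()

⊆⇒∈indicesWithin : ∀ {n m} (X : Vec (Subset m) n) V {j} → lookup X j ⊆ V → j ∈ indicesWithin X V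
⊆⇒∈indicesWithin X V {j} X[j]⊆V =
  lookup⇒[]= j _ (trans (lookup∘tabulate _ j) (dec-true (lookup X j ⊆? V) X[j]⊆V))

IsCBC⇒countWithin≤ : ∀ {n m} k (X : Vec (Subset m) n) → IsCBC k X → ∀ V → ∣ V ∣ < k → countWithin X V ≤ ∣ V ∣
IsCBC⇒countWithin≤ k X cbc V ∣V∣<k with countWithin X V ≤? ∣ V ∣
... | yes few     = few
... | no too-many with ⊆-ofSize (indicesWithin X V) (suc ∣ V ∣) (subst (suc ∣ V ∣ ≤_) (sym (∣indicesWithin∣ X V)) (≰⇒> too-many))
...   | I , I⊆ , ∣I∣≡1+∣V∣ = ⊥-elim (1+n≰n (begin
  suc ∣ V ∣              ≡⟨ ∣I∣≡1+∣V∣ ⟨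
  ∣ I ∣                  ≤⟨ cbc I (subst (1 ≤_) (sym ∣I∣≡1+∣V∣) (s≤s z≤n)) (subst (_≤ k) (sym ∣I∣≡1+∣V∣) ∣V∣<k) ⟩
  ∣ unionOver X I ∣      ≤⟨ p⊆q⇒∣p∣≤∣q∣ (unionOver-⊆ X I (∈indicesWithin⇒⊆ X V ∘ I⊆)) ⟩
  ∣ V ∣                  ∎))
  where open ≤-Reasoning

countWithin≤⇒IsCBC : ∀ {n m} k (X : Vec (Subset m) n) → (∀ V → ∣ V ∣ < k → countWithin X V ≤ ∣ V ∣) → IsCBC k X
countWithin≤⇒IsCBC k X few I _ ∣I∣≤k with ∣ I ∣ ≤? ∣ unionOver X I ∣
... | yes ∣I∣≤∣U∣ = ∣I∣≤∣U∣
... | no  ∣I∣≰∣U∣ = ⊥-elim (<⇒≱ ∣U∣<∣I∣ (begin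
  ∣ I ∣                       ≤⟨ p⊆q⇒∣p∣≤∣q∣ (⊆⇒∈indicesWithin X U ∘ ⊆-unionOver X I) ⟩
  ∣ indicesWithin X U ∣       ≡⟨ ∣indicesWithin∣ X U ⟩
  countWithin X U             ≤⟨ few U (<-≤-trans ∣U∣<∣I∣ ∣I∣≤k) ⟩
  ∣ U ∣                       ∎))
  where
  open ≤-Reasoning
  U : Subset _
  U = unionOver X I
  ∣U∣<∣I∣ : ∣ U ∣ < ∣ I ∣
  ∣U∣<∣I∣ = ≰⇒> ∣I∣≰∣U∣

-- Lower bound

d*t+1≤d*∣U∣+supersetsOfSize : ∀ {m} t d → t + d ≡ m → 1 ≤ d → (U : Subset m) →
  d * t + 1 ≤ d * ∣ U ∣ + supersetsOfSize t U
d*t+1≤d*∣U∣+supersetsOfSize {m} t d t+d≡m 1≤d U with ∣ U ∣ ≤? t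
... | no ∣U∣≰t = begin
  d * t + 1        ≤⟨ +-monoʳ-≤ (d * t) 1≤d ⟩
  d * t + d        ≡⟨ trans (+-comm (d * t) d) (sym (*-suc d t)) ⟩
  d * suc t        ≤⟨ *-monoʳ-≤ d (≰⇒> ∣U∣≰t) ⟩
  d * ∣ U ∣        ≤⟨ m≤m+n _ _ ⟩
  d * ∣ U ∣ + supersetsOfSize t U ∎
  where open ≤-Reasoning
... | yes ∣U∣≤t with m≤n⇒∃[o]m+o≡n ∣U∣≤t
...   | u , refl = begin
  d * (∣ U ∣ + u) + 1                     ≡⟨ cong (_+ 1) (*-distribˡ-+ d ∣ U ∣ u) ⟩
  d * ∣ U ∣ + d * u + 1                   ≡⟨ trans (+-assoc (d * ∣ U ∣) (d * u) 1) (cong (d * ∣ U ∣ +_) (+-comm (d * u) 1)) ⟩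
  d * ∣ U ∣ + (1 + d * u)                 ≤⟨ +-monoʳ-≤ (d * ∣ U ∣) (1+d*u≤[d+u]Cu d u) ⟩
  d * ∣ U ∣ + (d + u) C u                 ≡⟨ cong (λ c → d * ∣ U ∣ + c C u) ∣∁U∣≡d+u ⟨
  d * ∣ U ∣ + ∣ ∁ U ∣ C u                 ≡⟨ cong (d * ∣ U ∣ +_) (supersetsOfSize-+ U u) ⟨
  d * ∣ U ∣ + supersetsOfSize (∣ U ∣ + u) U ∎
  where
  open ≤-Reasoning
  ∣∁U∣≡d+u : ∣ ∁ U ∣ ≡ d + u
  ∣∁U∣≡d+u = begin-equality
    ∣ ∁ U ∣                        ≡⟨ ∣∁p∣≡n∸∣p∣ U ⟩
    m ∸ ∣ U ∣                      ≡⟨ cong (_∸ ∣ U ∣) t+d≡m ⟨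
    ∣ U ∣ + u + d ∸ ∣ U ∣          ≡⟨ cong (_∸ ∣ U ∣) (+-assoc ∣ U ∣ u d) ⟩
    ∣ U ∣ + (u + d) ∸ ∣ U ∣        ≡⟨ m+n∸m≡n ∣ U ∣ (u + d) ⟩
    u + d                          ≡⟨ +-comm u d ⟩
    d + u                          ∎

sum-map-supersetsOfSize-≤ : ∀ {n} m t (X : Vec (Subset m) n) → IsCBC (suc t) X →
  sum (map (supersetsOfSize t) X) ≤ t * (m C t)
sum-map-supersetsOfSize-≤ m t X cbc = begin
  sum (map (supersetsOfSize t) X)
    ≡⟨ sum-map-∑ m X (λ U T → 𝟙 (∣ T ∣ ≟ t) * 𝟙 (U ⊆? T)) ⟩
  ∑ m (λ T → sum (map (λ U → 𝟙 (∣ T ∣ ≟ t) * 𝟙 (U ⊆? T)) X))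
    ≡⟨ ∑-cong m (λ T → *-distribˡ-sum-map X (𝟙 (∣ T ∣ ≟ t)) (λ U → 𝟙 (U ⊆? T))) ⟨
  ∑ m (λ T → 𝟙 (∣ T ∣ ≟ t) * countWithin X T)
    ≤⟨ ∑-mono-≤ m (λ T → 𝟙≟-*-mono-≤ ∣ T ∣ t λ ∣T∣≡t →
         subst (countWithin X T ≤_) ∣T∣≡t (IsCBC⇒countWithin≤ (suc t) X cbc T (s≤s (≤-reflexive ∣T∣≡t)))) ⟩
  ∑ m (λ T → 𝟙 (∣ T ∣ ≟ t) * t)
    ≡⟨ ∑-cong m (λ T → *-comm (𝟙 (∣ T ∣ ≟ t)) t) ⟩
  ∑ m (λ T → t * 𝟙 (∣ T ∣ ≟ t))
    ≡⟨ *-distribˡ-∑ m t _ ⟨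
  t * ∑ m (λ T → 𝟙 (∣ T ∣ ≟ t))
    ≡⟨ cong (t *_) (∑-ofSize m t) ⟩
  t * (m C t) ∎
  where open ≤-Reasoning

n*[d*t+1]≤d*N+t*mCt : ∀ {n m} t d → t + d ≡ m → 1 ≤ d → (X : Vec (Subset m) n) → IsCBC (suc t) X →
  n * (d * t + 1) ≤ d * totalSize X + t * (m C t)
n*[d*t+1]≤d*N+t*mCt {n} {m} t d t+d≡m 1≤d X cbc = begin
  n * (d * t + 1)
    ≡⟨ sum-map-const X (d * t + 1) ⟨
  sum (map (λ _ → d * t + 1) X)
    ≤⟨ sum-map-mono-≤ X (d*t+1≤d*∣U∣+supersetsOfSize t d t+d≡m 1≤d) ⟩
  sum (map (λ U → d * ∣ U ∣ + supersetsOfSize t U) X)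
    ≡⟨ sum-map-distrib-+ X (λ U → d * ∣ U ∣) (supersetsOfSize t) ⟩
  sum (map (λ U → d * ∣ U ∣) X) + sum (map (supersetsOfSize t) X)
    ≤⟨ +-mono-≤ (≤-reflexive (sym (*-distribˡ-sum-map X d ∣_∣))) (sum-map-supersetsOfSize-≤ m t X cbc) ⟩
  d * sum (map ∣_∣ X) + t * (m C t)
    ≡⟨ cong (λ N → d * N + t * (m C t)) (totalSize≡sum X) ⟨
  d * totalSize X + t * (m C t) ∎
  where open ≤-Reasoning

m*n≤o⇒m≤o/n : ∀ m n o .{{_ : NonZero n}} → m * n ≤ o → m ≤ o / n
m*n≤o⇒m≤o/n m n o m*n≤o = subst (_≤ o / n) (m*n/n≡m m n) (/-monoˡ-≤ n m*n≤o)

n*t∸[a∸n]/d≤N : ∀ n t d N a .{{_ : NonZero d}} → n * (d * t + 1) ≤ d * N + a → n * t ∸ (a ∸ n) / d ≤ N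
n*t∸[a∸n]/d≤N n t d N a bound with n * t ≤? N
... | yes n*t≤N = ≤-trans (m∸n≤m (n * t) ((a ∸ n) / d)) n*t≤N
... | no  n*t≰N with m≤n⇒∃[o]m+o≡n (<⇒≤ (≰⇒> n*t≰N))
...   | e , N+e≡n*t = begin
  n * t ∸ (a ∸ n) / d   ≤⟨ ∸-monoʳ-≤ (n * t) e≤[a∸n]/d ⟩
  n * t ∸ e             ≡⟨ cong (_∸ e) N+e≡n*t ⟨
  N + e ∸ e             ≡⟨ m+n∸n≡m N e ⟩
  N                     ∎
  where
  open ≤-Reasoning
  d*e+n≤a : d * e + n ≤ a
  d*e+n≤a = +-cancelˡ-≤ (d * N) _ _ (begin
    d * N + (d * e + n)   ≡⟨ solve 4 (λ d N e n → d :* N :+ (d :* e :+ n) := d :* (N :+ e) :+ n) refl d N e n ⟩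
    d * (N + e) + n       ≡⟨ cong (λ x → d * x + n) N+e≡n*t ⟩
    d * (n * t) + n       ≡⟨ solve 3 (λ d n t → d :* (n :* t) :+ n := n :* (d :* t :+ con 1)) refl d n t ⟩
    n * (d * t + 1)       ≤⟨ bound ⟩
    d * N + a             ∎)
  e≤[a∸n]/d : e ≤ (a ∸ n) / d
  e≤[a∸n]/d = m*n≤o⇒m≤o/n e d (a ∸ n) (m+n≤o⇒m≤o∸n (e * d) (subst (λ x → x + n ≤ a) (*-comm d e) d*e+n≤a))

totalSize-lowerBound : ∀ {n m} t → suc t ≤ m → (X : Vec (Subset m) n) → IsCBC (suc t) X →
  n * t ∸ (t * (m C t) ∸ n) / suc (m ∸ suc t) ≤ totalSize X
totalSize-lowerBound {n} {m} t 1+t≤m X cbc =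
  n*t∸[a∸n]/d≤N n t d (totalSize X) (t * (m C t)) (n*[d*t+1]≤d*N+t*mCt t d t+d≡m (s≤s z≤n) X cbc)
  where
  d : ℕ
  d = suc (m ∸ suc t)
  t+d≡m : t + d ≡ m
  t+d≡m = trans (+-suc t (m ∸ suc t)) (m+[n∸m]≡n 1+t≤m)

-- Upper bound: an extremal family

∑-shrink : ∀ m (f : Subset m → ℕ) q → q ≤ ∑ m f → Σ[ g ∈ (Subset m → ℕ) ] (∀ S → g S ≤ f S) × ∑ m g ≡ q
∑-shrink zero    f q q≤f = (λ _ → q) , (λ where [] → q≤f) , refl
∑-shrink (suc m) f q q≤∑f with q ≤? ∑ m (f ∘ (inside ∷_))
... | yes q≤∑f₁ with ∑-shrink m (f ∘ (inside ∷_)) q q≤∑f₁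
...   | g₁ , g₁≤f₁ , ∑g₁≡q = g , g≤f , trans (cong₂ _+_ ∑g₁≡q (∑-zero m (λ _ → refl))) (+-identityʳ q)
  where
  g : Subset (suc m) → ℕ
  g (inside  ∷ S) = g₁ S
  g (outside ∷ S) = 0
  g≤f : ∀ S → g S ≤ f S
  g≤f (inside  ∷ S) = g₁≤f₁ S
  g≤f (outside ∷ S) = z≤n
∑-shrink (suc m) f q q≤∑f | no q≰∑f₁ with ∑-shrink m (f ∘ (outside ∷_)) (q ∸ ∑ m (f ∘ (inside ∷_)))
                                            (m≤n+o⇒m∸n≤o q _ q≤∑f)
...   | g₀ , g₀≤f₀ , ∑g₀≡q∸∑f₁ = g , g≤f , trans (cong (∑ m (f ∘ (inside ∷_)) +_) ∑g₀≡q∸∑f₁)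
                                                 (m+[n∸m]≡n (<⇒≤ (≰⇒> q≰∑f₁)))
  where
  g : Subset (suc m) → ℕ
  g (inside  ∷ S) = f (inside ∷ S)
  g (outside ∷ S) = g₀ S
  g≤f : ∀ S → g S ≤ f S
  g≤f (inside  ∷ S) = ≤-refl
  g≤f (outside ∷ S) = g₀≤f₀ S

multisetVec : ∀ m (μ : Subset m → ℕ) → Vec (Subset m) (∑ m μ)
multisetVec zero    μ = replicate (μ []) []
multisetVec (suc m) μ = map (inside ∷_) (multisetVec m (μ ∘ (inside ∷_))) ++ map (outside ∷_) (multisetVec m (μ ∘ (outside ∷_)))

sum-map-multisetVec : ∀ m (μ : Subset m → ℕ) f → sum (map f (multisetVec m μ)) ≡ ∑ m (λ U → μ U * f U)
sum-map-multisetVec zero    μ f = sum-map-replicate (μ [])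
  where
  sum-map-replicate : ∀ k → sum (map f (replicate k [])) ≡ k * f []
  sum-map-replicate zero    = refl
  sum-map-replicate (suc k) = cong (f [] +_) (sum-map-replicate k)
sum-map-multisetVec (suc m) μ f = begin
  sum (map f (map (inside ∷_) V₁ ++ map (outside ∷_) V₀))
    ≡⟨ cong sum (map-++ f (map (inside ∷_) V₁) _) ⟩
  sum (map f (map (inside ∷_) V₁) ++ map f (map (outside ∷_) V₀))
    ≡⟨ sum-++ (map f (map (inside ∷_) V₁)) ⟩
  sum (map f (map (inside ∷_) V₁)) + sum (map f (map (outside ∷_) V₀))
    ≡⟨ cong₂ _+_ (cong sum (map-∘ f (inside ∷_) V₁)) (cong sum (map-∘ f (outside ∷_) V₀)) ⟨
  sum (map (f ∘ (inside ∷_)) V₁) + sum (map (f ∘ (outside ∷_)) V₀)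
    ≡⟨ cong₂ _+_ (sum-map-multisetVec m _ _) (sum-map-multisetVec m _ _) ⟩
  ∑ (suc m) (λ U → μ U * f U) ∎
  where
  open ≡-Reasoning
  V₁ : Vec (Subset m) (∑ m (μ ∘ (inside ∷_)))
  V₁ = multisetVec m (μ ∘ (inside ∷_))
  V₀ : Vec (Subset m) (∑ m (μ ∘ (outside ∷_)))
  V₀ = multisetVec m (μ ∘ (outside ∷_))

sum-map-subst : ∀ {A : Set} {a b} (a≡b : a ≡ b) (xs : Vec A a) f → sum (map f (subst (Vec A) a≡b xs)) ≡ sum (map f xs)
sum-map-subst refl xs f = refl

-- Families are given by multiplicity functions Subset m → ℕ: σ picks q distinct s-sets, and room T
-- is how often the (s + 1)-set T may still be used without violating the Hall-type condition at T.
module Construction (m s : ℕ) {q} (q≤mCs : q ≤ m C s) where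

  chosen : Σ[ σ ∈ (Subset m → ℕ) ] (∀ S → σ S ≤ 𝟙 (∣ S ∣ ≟ s)) × ∑ m σ ≡ q
  chosen = ∑-shrink m (λ S → 𝟙 (∣ S ∣ ≟ s)) q (subst (q ≤_) (sym (∑-ofSize m s)) q≤mCs)

  σ : Subset m → ℕ
  σ = proj₁ chosen

  σ-off-size : ∀ S → ∣ S ∣ ≢ s → σ S ≡ 0
  σ-off-size S ∣S∣≢s = n≤0⇒n≡0 (subst (σ S ≤_) (𝟙-no (∣ S ∣ ≟ s) ∣S∣≢s) (proj₁ (proj₂ chosen) S))

  ∑σ≡q : ∑ m σ ≡ q
  ∑σ≡q = proj₂ (proj₂ chosen)

  covered : Subset m → ℕ
  covered T = ∑ m (λ S → σ S * 𝟙 (S ⊆? T))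

  covered≤∣T∣Cs : ∀ T → covered T ≤ ∣ T ∣ C s
  covered≤∣T∣Cs T = begin
    ∑ m (λ S → σ S * 𝟙 (S ⊆? T))                  ≤⟨ ∑-mono-≤ m (λ S → *-monoˡ-≤ (𝟙 (S ⊆? T)) (proj₁ (proj₂ chosen) S)) ⟩
    ∑ m (λ S → 𝟙 (∣ S ∣ ≟ s) * 𝟙 (S ⊆? T))        ≡⟨ ∑-ofSize-⊆ T s ⟩
    ∣ T ∣ C s                                      ∎
    where open ≤-Reasoning

  room : Subset m → ℕ
  room T = 𝟙 (∣ T ∣ ≟ suc s) * (suc s ∸ covered T)

  room-off-size : ∀ T → ∣ T ∣ ≢ suc s → room T ≡ 0
  room-off-size T ∣T∣≢1+s = cong (_* (suc s ∸ covered T)) (𝟙-no (∣ T ∣ ≟ suc s) ∣T∣≢1+s)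

  ∑room-≥ : suc s * (m C suc s) ∸ (m ∸ s) * q ≤ ∑ m room
  ∑room-≥ = begin
    suc s * (m C suc s) ∸ (m ∸ s) * q
      ≤⟨ ∸-mono (≤-reflexive all-rooms) ∑covered≤ ⟩
    ∑ m (λ T → 𝟙 (∣ T ∣ ≟ suc s) * suc s) ∸ ∑ m (λ T → 𝟙 (∣ T ∣ ≟ suc s) * covered T)
      ≤⟨ ∑-∸ m _ _ ⟩
    ∑ m (λ T → 𝟙 (∣ T ∣ ≟ suc s) * suc s ∸ 𝟙 (∣ T ∣ ≟ suc s) * covered T)
      ≡⟨ ∑-cong m (λ T → *-distribˡ-∸ (𝟙 (∣ T ∣ ≟ suc s)) (suc s) (covered T)) ⟨
    ∑ m room ∎
    where
    open ≤-Reasoning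
    all-rooms : suc s * (m C suc s) ≡ ∑ m (λ T → 𝟙 (∣ T ∣ ≟ suc s) * suc s)
    all-rooms = begin-equality
      suc s * (m C suc s)                        ≡⟨ cong (suc s *_) (∑-ofSize m (suc s)) ⟨
      suc s * ∑ m (λ T → 𝟙 (∣ T ∣ ≟ suc s))      ≡⟨ *-distribˡ-∑ m (suc s) _ ⟩
      ∑ m (λ T → suc s * 𝟙 (∣ T ∣ ≟ suc s))      ≡⟨ ∑-cong m (λ T → *-comm (suc s) _) ⟩
      ∑ m (λ T → 𝟙 (∣ T ∣ ≟ suc s) * suc s)      ∎
    ∑covered≤ : ∑ m (λ T → 𝟙 (∣ T ∣ ≟ suc s) * covered T) ≤ (m ∸ s) * q
    ∑covered≤ = begin
      ∑ m (λ T → 𝟙 (∣ T ∣ ≟ suc s) * covered T)       ≡⟨ ∑-incidence m (suc s) σ ⟩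
      ∑ m (λ S → σ S * supersetsOfSize (suc s) S)     ≡⟨ ∑-cong m (λ S → *-congˡ-on (σ S) (σ-off-size S) (supersetsOfSize-suc S)) ⟩
      ∑ m (λ S → σ S * (m ∸ s))                       ≡⟨ ∑-cong m (λ S → *-comm (σ S) (m ∸ s)) ⟩
      ∑ m (λ S → (m ∸ s) * σ S)                       ≡⟨ *-distribˡ-∑ m (m ∸ s) σ ⟨
      (m ∸ s) * ∑ m σ                                 ≡⟨ cong ((m ∸ s) *_) ∑σ≡q ⟩
      (m ∸ s) * q                                     ∎

  roomWithin : Subset m → ℕ
  roomWithin V = ∑ m (λ T → room T * 𝟙 (T ⊆? V))

  covered+roomWithin≤-full : ∀ V → ∣ V ∣ ≡ suc s → covered V + roomWithin V ≤ ∣ V ∣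
  covered+roomWithin≤-full V ∣V∣≡1+s = begin
    covered V + roomWithin V                  ≡⟨ cong (covered V +_) (∑-single m V room-off-V) ⟩
    covered V + room V * 𝟙 (V ⊆? V)           ≤⟨ +-monoʳ-≤ (covered V) room-V≤ ⟩
    covered V + (suc s ∸ covered V)           ≡⟨ m+[n∸m]≡n covered≤1+s ⟩
    suc s                                     ≡⟨ ∣V∣≡1+s ⟨
    ∣ V ∣                                     ∎
    where
    open ≤-Reasoning
    covered≤1+s : covered V ≤ suc s
    covered≤1+s = ≤-trans (covered≤∣T∣Cs V) (≤-reflexive (trans (cong (_C s) ∣V∣≡1+s) ([1+s]Cs≡1+s s)))
    room-V≤ : room V * 𝟙 (V ⊆? V) ≤ suc s ∸ covered V
    room-V≤ = begin
      room V * 𝟙 (V ⊆? V)     ≡⟨ *-comm (room V) _ ⟩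
      𝟙 (V ⊆? V) * room V     ≤⟨ 𝟙*x≤x (V ⊆? V) (room V) ⟩
      room V                  ≤⟨ 𝟙*x≤x (∣ V ∣ ≟ suc s) _ ⟩
      suc s ∸ covered V       ∎
    room-off-V : ∀ T → T ≢ V → room T * 𝟙 (T ⊆? V) ≡ 0
    room-off-V T T≢V with T ⊆? V
    ... | no  _   = *-zeroʳ (room T)
    ... | yes T⊆V = trans (*-identityʳ (room T))
          (room-off-size T (λ ∣T∣≡1+s → T≢V (⊆∧∣≡∣⇒≡ T⊆V (trans ∣T∣≡1+s (sym ∣V∣≡1+s)))))

  covered+roomWithin≤-small : 1 ≤ s → ∀ V → ∣ V ∣ < suc s → covered V + roomWithin V ≤ ∣ V ∣
  covered+roomWithin≤-small 1≤s V ∣V∣≤s = begin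
    covered V + roomWithin V     ≡⟨ trans (cong (covered V +_) (∑-zero m room-off)) (+-identityʳ _) ⟩
    covered V                    ≤⟨ covered≤∣T∣Cs V ⟩
    ∣ V ∣ C s                    ≤⟨ vCs≤v (≤-pred ∣V∣≤s) 1≤s ⟩
    ∣ V ∣                        ∎
    where
    open ≤-Reasoning
    room-off : ∀ T → room T * 𝟙 (T ⊆? V) ≡ 0
    room-off T with T ⊆? V
    ... | no  _   = *-zeroʳ (room T)
    ... | yes T⊆V = trans (*-identityʳ (room T)) (room-off-size T (<⇒≢ (≤-<-trans (p⊆q⇒∣p∣≤∣q∣ T⊆V) ∣V∣≤s)))

  module TopUp {r} (r≤∑room : r ≤ ∑ m room) where

    added : Σ[ ρ ∈ (Subset m → ℕ) ] (∀ T → ρ T ≤ room T) × ∑ m ρ ≡ r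
    added = ∑-shrink m room r r≤∑room

    ρ : Subset m → ℕ
    ρ = proj₁ added

    ρ≤room : ∀ T → ρ T ≤ room T
    ρ≤room = proj₁ (proj₂ added)

    ρ-off-size : ∀ T → ∣ T ∣ ≢ suc s → ρ T ≡ 0
    ρ-off-size T ∣T∣≢1+s = n≤0⇒n≡0 (subst (ρ T ≤_) (room-off-size T ∣T∣≢1+s) (ρ≤room T))

    μ : Subset m → ℕ
    μ U = σ U + ρ U

    ∑μ≡q+r : ∑ m μ ≡ q + r
    ∑μ≡q+r = trans (∑-distrib-+ m σ ρ) (cong₂ _+_ ∑σ≡q (proj₂ (proj₂ added)))

    ∑μ*∣U∣ : ∑ m (λ U → μ U * ∣ U ∣) ≡ q * s + r * suc s
    ∑μ*∣U∣ = begin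
      ∑ m (λ U → μ U * ∣ U ∣)                          ≡⟨ ∑-cong m (λ U → *-distribʳ-+ ∣ U ∣ (σ U) (ρ U)) ⟩
      ∑ m (λ U → σ U * ∣ U ∣ + ρ U * ∣ U ∣)            ≡⟨ ∑-distrib-+ m _ _ ⟩
      ∑ m (λ U → σ U * ∣ U ∣) + ∑ m (λ U → ρ U * ∣ U ∣)
        ≡⟨ cong₂ _+_ (∑-cong m (λ U → *-congˡ-on (σ U) (σ-off-size U) id))
                     (∑-cong m (λ U → *-congˡ-on (ρ U) (ρ-off-size U) id)) ⟩
      ∑ m (λ U → σ U * s) + ∑ m (λ U → ρ U * suc s)
        ≡⟨ cong₂ _+_ (trans (∑-cong m (λ U → *-comm (σ U) s)) (sym (*-distribˡ-∑ m s σ)))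
                     (trans (∑-cong m (λ U → *-comm (ρ U) (suc s))) (sym (*-distribˡ-∑ m (suc s) ρ))) ⟩
      s * ∑ m σ + suc s * ∑ m ρ                        ≡⟨ cong₂ (λ a b → s * a + suc s * b) ∑σ≡q (proj₂ (proj₂ added)) ⟩
      s * q + suc s * r                                ≡⟨ cong₂ _+_ (*-comm s q) (*-comm (suc s) r) ⟩
      q * s + r * suc s                                ∎
      where open ≡-Reasoning

    ∑μ-within≤ : 1 ≤ s → ∀ V → ∣ V ∣ < suc (suc s) → ∑ m (λ U → μ U * 𝟙 (U ⊆? V)) ≤ ∣ V ∣
    ∑μ-within≤ 1≤s V ∣V∣<2+s = begin
      ∑ m (λ U → μ U * 𝟙 (U ⊆? V))
        ≡⟨ trans (∑-cong m (λ U → *-distribʳ-+ (𝟙 (U ⊆? V)) (σ U) (ρ U))) (∑-distrib-+ m _ _) ⟩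
      covered V + ∑ m (λ T → ρ T * 𝟙 (T ⊆? V))
        ≤⟨ +-monoʳ-≤ (covered V) (∑-mono-≤ m (λ T → *-monoˡ-≤ (𝟙 (T ⊆? V)) (ρ≤room T))) ⟩
      covered V + roomWithin V
        ≤⟨ by-size (∣ V ∣ ≟ suc s) ⟩
      ∣ V ∣ ∎
      where
      open ≤-Reasoning
      by-size : Dec (∣ V ∣ ≡ suc s) → covered V + roomWithin V ≤ ∣ V ∣
      by-size (yes ∣V∣≡1+s) = covered+roomWithin≤-full V ∣V∣≡1+s
      by-size (no  ∣V∣≢1+s) = covered+roomWithin≤-small 1≤s V (≤∧≢⇒< (≤-pred ∣V∣<2+s) ∣V∣≢1+s)

m∸s≡2+[m∸[2+s]] : ∀ {m s} → suc (suc s) ≤ m → m ∸ s ≡ suc (suc (m ∸ suc (suc s)))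
m∸s≡2+[m∸[2+s]] {suc (suc m)} {zero}  _          = refl
m∸s≡2+[m∸[2+s]] {suc m}       {suc s} (s≤s 2+s≤m) = m∸s≡2+[m∸[2+s]] 2+s≤m

n∸q+[1+d]*q≤c : ∀ {n q d c} → q ≤ n → q * d + n ≤ c → n ∸ q + suc d * q ≤ c
n∸q+[1+d]*q≤c {n} {q} {d} {c} q≤n q*d+n≤c = begin
  n ∸ q + (q + d * q)     ≡⟨ +-assoc (n ∸ q) q (d * q) ⟨
  n ∸ q + q + d * q       ≡⟨ cong (_+ d * q) (m∸n+n≡m q≤n) ⟩
  n + d * q               ≡⟨ trans (+-comm n (d * q)) (cong (_+ n) (*-comm d q)) ⟩
  q * d + n               ≤⟨ q*d+n≤c ⟩
  c                       ∎
  where open ≤-Reasoning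

[a∸n]/d≤b : ∀ {a b} n d .{{_ : NonZero d}} → a ≡ suc d * b → b ≤ n → (a ∸ n) / d ≤ b
[a∸n]/d≤b {a} {b} n d a≡[1+d]*b b≤n = *-cancelʳ-≤ ((a ∸ n) / d) b d (begin
  (a ∸ n) / d * d    ≤⟨ m/n*n≤m (a ∸ n) d ⟩
  a ∸ n              ≤⟨ ∸-monoʳ-≤ a b≤n ⟩
  a ∸ b              ≡⟨ cong (_∸ b) a≡[1+d]*b ⟩
  b + d * b ∸ b      ≡⟨ m+n∸m≡n b (d * b) ⟩
  d * b              ≡⟨ *-comm d b ⟩
  b * d              ∎)
  where open ≤-Reasoning

q*s+[n∸q]*[1+s]≡n*[1+s]∸q : ∀ {q n} s → q ≤ n → q * s + (n ∸ q) * suc s ≡ n * suc s ∸ q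
q*s+[n∸q]*[1+s]≡n*[1+s]∸q {q} {n} s q≤n = begin
  q * s + (n ∸ q) * suc s                  ≡⟨ m+n∸n≡m _ q ⟨
  q * s + (n ∸ q) * suc s + q ∸ q          ≡⟨ cong (_∸ q) (solve 3 (λ q r s → q :* s :+ r :* (con 1 :+ s) :+ q := (r :+ q) :* (con 1 :+ s)) refl q (n ∸ q) s) ⟩
  (n ∸ q + q) * suc s ∸ q                  ≡⟨ cong (λ x → x * suc s ∸ q) (m∸n+n≡m q≤n) ⟩
  n * suc s ∸ q                            ∎
  where open ≡-Reasoning

CBC-upperBound : ∀ m s n → 1 ≤ s → suc (suc s) ≤ m → m C s ≤ n → n ≤ suc s * (m C suc s) →
  CBC n (n * suc s ∸ (suc s * (m C suc s) ∸ n) / suc (m ∸ suc (suc s))) (suc (suc s)) m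
CBC-upperBound m s n 1≤s 2+s≤m mCs≤n n≤c = X , countWithin≤⇒IsCBC (suc (suc s)) X within≤ , size
  where
  d c q : ℕ
  d = suc (m ∸ suc (suc s))
  c = suc s * (m C suc s)
  q = (c ∸ n) / d

  c≡[1+d]*mCs : c ≡ suc d * (m C s)
  c≡[1+d]*mCs = trans ([1+s]*mC[1+s]≡[m∸s]*mCs m s) (cong (_* (m C s)) (m∸s≡2+[m∸[2+s]] 2+s≤m))

  q≤mCs : q ≤ m C s
  q≤mCs = [a∸n]/d≤b n d c≡[1+d]*mCs mCs≤n

  q≤n : q ≤ n
  q≤n = ≤-trans q≤mCs mCs≤n

  open Construction m s q≤mCs

  n∸q≤∑room : n ∸ q ≤ ∑ m room
  n∸q≤∑room = ≤-trans
    (m+n≤o⇒m≤o∸n (n ∸ q) (subst (λ e → n ∸ q + e * q ≤ c) (sym (m∸s≡2+[m∸[2+s]] 2+s≤m))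
                               (n∸q+[1+d]*q≤c q≤n (m≤o∸n⇒m+n≤o (q * d) n≤c (m/n*n≤m (c ∸ n) d)))))
    ∑room-≥

  open TopUp n∸q≤∑room

  length≡n : ∑ m μ ≡ n
  length≡n = trans ∑μ≡q+r (m+[n∸m]≡n q≤n)

  X : Vec (Subset m) n
  X = subst (Vec (Subset m)) length≡n (multisetVec m μ)

  sum-map-X : ∀ f → sum (map f X) ≡ ∑ m (λ U → μ U * f U)
  sum-map-X f = trans (sum-map-subst length≡n (multisetVec m μ) f) (sum-map-multisetVec m μ f)

  within≤ : ∀ V → ∣ V ∣ < suc (suc s) → countWithin X V ≤ ∣ V ∣
  within≤ V ∣V∣<2+s = subst (_≤ ∣ V ∣) (sym (sum-map-X (λ U → 𝟙 (U ⊆? V)))) (∑μ-within≤ 1≤s V ∣V∣<2+s)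

  size : totalSize X ≡ n * suc s ∸ q
  size = trans (totalSize≡sum X) (trans (sum-map-X ∣_∣) (trans ∑μ*∣U∣ (q*s+[n∸q]*[1+s]≡n*[1+s]∸q s q≤n)))

theorem3p2 : (k m n : ℕ) → 3 ≤ k → k ≤ m →
    m C (k ∸ 2) ≤ n → n ≤ (k ∸ 1) * (m C (k ∸ 1)) →
    IsMinN n k m (n * (k ∸ 1) ∸ (((k ∸ 1) * (m C (k ∸ 1)) ∸ n) / suc (m ∸ k)))
theorem3p2 (suc (suc (suc s))) m n _ k≤m mCs≤n n≤c =
  CBC-upperBound m (suc s) n (s≤s z≤n) k≤m mCs≤n n≤c ,
  λ where N (X , cbc , size≡N) → subst (_ ≤_) size≡N (totalSize-lowerBound (suc (suc s)) k≤m X cbc)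
theorem3p2 (suc zero)       _ _ (s≤s ())
theorem3p2 (suc (suc zero)) _ _ (s≤s (s≤s ()))
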